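{- For each integer $k\ge 3$, the equivalence class of $K_{1,k}$ with respect to $\equiv$ in $\mathcal{H}$ is $\{K_{1,k},K^+_{1,k}\}$. Moreover, $\{K_{1,k+1},K^+_{1,k+1}\}$ is immediately after $\{K_{1,k},K^+_{1,k}\}$ in $(\mathcal{H}/\!\equiv,\le)$, i.e., $\{K_{1,k},K^+_{1,k}\}<\{K_{1,k+1},K^+_{1,k+1}\}$ and there is no equivalence class strictly between them.
   Context: All graphs are finite and simple, considered up to isomorphism. An edge-colored graph is a pair $(G,c)$ with $c\colon E(G)\to\mathbb{N}$ an arbitrary map (not necessarily proper); it is colored in $t$ or more colors if $|c(E(G))|\ge t$. A subgraph (not necessarily induced) is rainbow if its edges receive pairwise distinct colors. $(G,c)$ is rainbow $H$-free if $G$ contains no rainbow subgraph isomorphic to $H$. For graphs $H_1,H_2$, write $H_1\le H_2$ if there is a positive integer $t$ such that every rainbow $H_1$-free edge-colored complete graph colored in $t$ or more colors is rainbow $H_2$-free. $\mathcal{H}$ denotes the set of connected finite simple graphs other than the paths $P_1,P_2,P_3,P_4$ ($P_k$ is the path on $k$ vertices). On $\mathcal{H}$, $H_1\equiv H_2$ means $H_1\le H_2$ and $H_2\le H_1$; for equivalence classes $\mathcal{A},\mathcal{B}$, $\mathcal{A}\le\mathcal{B}$ means $H_1\le H_2$ for some $H_1\in\mathcal{A}$, $H_2\in\mathcal{B}$; this is a partial order on $\mathcal{H}/\!\equiv$. $K_{1,k}$ is the star with $k$ leaves, and $K^+_{1,k}$ is obtained from $K_{1,k}$ by subdividing one edge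 with one new vertex. -}

module Defs where

open import Data.Bool using (Bool; true; false; not; _∧_; _∨_)
open import Data.Bool.Properties using (∨-comm)
open import Data.Nat using (ℕ; zero; suc; _≤_; _<_; _≡ᵇ_; _<ᵇ_)
open import Data.Nat.Properties using () renaming (_≟_ to _≟ℕ_)
open import Data.Fin using (Fin; toℕ)
open import Data.List using (List; length; filterᵇ; map; cartesianProduct; deduplicate; allFin)
open import Data.Product using (Σ; _×_; _,_; proj₁; proj₂)
open import Data.Sum using (_⊎_)
open import Function.Definitions using (Injective)
open import Function.Bundles using (_↔_; Inverse)
open import Relation.Binary.PropositionalEquality using (_≡_; _≢_; refl; trans)
open import Relation.Nullary using (¬_)

record Graph : Set where
  field
    order   : ℕ
    adj     : Fin order → Fin order → Bool
    adj-sym : ∀ i j → adj i j ≡ adj j i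
    adj-irr : ∀ i → adj i i ≡ false
open Graph public

mkGraph : (n : ℕ) (r : ℕ → ℕ → Bool) → (∀ x → r x x ≡ false) → Graph
mkGraph n r irr = record
  { order   = n
  ; adj     = λ i j → r (toℕ i) (toℕ j) ∨ r (toℕ j) (toℕ i)
  ; adj-sym = λ i j → ∨-comm (r (toℕ i) (toℕ j)) (r (toℕ j) (toℕ i))
  ; adj-irr = λ i → trans (cong-∨ (irr (toℕ i))) refl
  }
  where
  cong-∨ : ∀ {a} → a ≡ false → a ∨ a ≡ false
  cong-∨ refl = refl

_≅_ : Graph → Graph → Set
G ≅ H = Σ (Fin (order G) ↔ Fin (order H)) λ f →
          ∀ i j → adj H (Inverse.to f i) (Inverse.to f j) ≡ adj G i j

data Reach (G : Graph) : Fin (order G) → Fin (order G) → Set where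
  here : ∀ {u} → Reach G u u
  step : ∀ {u v w} → adj G u v ≡ true → Reach G v w → Reach G u w

Connected : Graph → Set
Connected G = (1 ≤ order G) × (∀ u v → Reach G u v)

pathRel : ℕ → ℕ → Bool
pathRel x y = suc x ≡ᵇ y

pathRel-irr : ∀ x → pathRel x x ≡ false
pathRel-irr zero    = refl
pathRel-irr (suc x) = pathRel-irr x

P : ℕ → Graph
P m = mkGraph m pathRel pathRel-irr

starRel : ℕ → ℕ → Bool
starRel x y = (x ≡ᵇ 0) ∧ not (y ≡ᵇ 0)

starRel-irr : ∀ x → starRel x x ≡ false
starRel-irr zero    = refl
starRel-irr (suc x) = refl

K1 : ℕ → Graph
K1 k = mkGraph (suc k) starRel starRel-irr

-- K^+_{1,k} for k = suc m: center 0, leaves 1..k, extra vertex k+1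
-- joined to leaf 1 (the star with the edge 0–1 subdivided, up to
-- isomorphism: path 0–1–(k+1) plus leaves 2..k at 0).
plusRel : ℕ → ℕ → ℕ → Bool
plusRel m x y = ((x ≡ᵇ 0) ∧ not (y ≡ᵇ 0) ∧ (y <ᵇ suc (suc m)))
              ∨ ((x ≡ᵇ 1) ∧ (y ≡ᵇ suc (suc m)))

plusRel-irr : ∀ m x → plusRel m x x ≡ false
plusRel-irr m zero          = refl
plusRel-irr m (suc zero)    = refl
plusRel-irr m (suc (suc x)) = refl

-- K1plus k is K^+_{1,k}, defined for k ≥ 1 (for k = 0 it is unused).
K1plus : ℕ → Graph
K1plus zero    = P 2
K1plus (suc m) = mkGraph (suc (suc (suc m))) (plusRel m) (plusRel-irr m)

record Coloring (n : ℕ) : Set where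
  field
    col     : Fin n → Fin n → ℕ
    col-sym : ∀ i j → col i j ≡ col j i
open Coloring public

edgesK : (n : ℕ) → List (Fin n × Fin n)
edgesK n = filterᵇ (λ p → toℕ (proj₁ p) <ᵇ toℕ (proj₂ p))
                   (cartesianProduct (allFin n) (allFin n))

numColors : ∀ {n} → Coloring n → ℕ
numColors {n} c = length (deduplicate _≟ℕ_ (map (λ p → col c (proj₁ p) (proj₂ p)) (edgesK n)))

SameEdge : ∀ {m} → Fin m → Fin m → Fin m → Fin m → Set
SameEdge u v u' v' = (u ≡ u' × v ≡ v') ⊎ (u ≡ v' × v ≡ u')

RainbowCopy : (H : Graph) → ∀ {n} → Coloring n → Set
RainbowCopy H {n} c =
  Σ (Fin (order H) → Fin n) λ f →
    Injective _≡_ _≡_ f ×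
    (∀ u v u' v' → adj H u v ≡ true → adj H u' v' ≡ true →
       ¬ SameEdge u v u' v' → col c (f u) (f v) ≢ col c (f u') (f v'))

RainbowFree : (H : Graph) → ∀ {n} → Coloring n → Set
RainbowFree H c = ¬ RainbowCopy H c

_≼_ : Graph → Graph → Set
H₁ ≼ H₂ = Σ ℕ λ t → 1 ≤ t ×
  (∀ n (c : Coloring n) → t ≤ numColors c → RainbowFree H₁ c → RainbowFree H₂ c)

_≈ᵍ_ : Graph → Graph → Set
H₁ ≈ᵍ H₂ = (H₁ ≼ H₂) × (H₂ ≼ H₁)

InH : Graph → Set
InH H = Connected H × ¬ (H ≅ P 1) × ¬ (H ≅ P 2) × ¬ (H ≅ P 3) × ¬ (H ≅ P 4)

{-# OPTIONS --safe #-}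

-- K_{1,k} is a subgraph of K⁺_{1,k} and of K_{1,k+1}, hence below both.  Conversely K⁺_{1,k} ≤ K_{1,k}:
-- if a colouring has more than (k+2)² colours but no rainbow K⁺_{1,k}, a rainbow K_{1,k} can be grown
-- twice, since an edge whose colour does not occur among the vertices of a rainbow star either adds
-- a leaf or closes a rainbow K⁺_{1,k}; and a rainbow K_{1,k+2} contains a rainbow K⁺_{1,k}.
-- Stars are strictly ordered: splitting K_n into blocks of s ≥ 2 vertices and giving colour 0 to all
-- edges between blocks leaves each vertex only s colours, so there is a rainbow K_{1,s} but no rainbow
-- K_{1,s+1}, while the number of colours grows with n.  Finally, a connected H ≤ K_{1,b} must have
-- rainbow copies in two colourings of K_n with a rainbow star at vertex 0: giving colour 0 to every
-- other edge forces a vertex of H missed by at most one edge, and colouring xy by max(x, y) forbids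
-- triangles.  Such an H is a star or a subdivided star, and comparing stars pins down its size.
module Submission where

open import Defs
open import Data.Bool using (Bool; true; false; not; _∧_; _∨_; _xor_; if_then_else_)
open import Data.Bool.Properties as Bool using (∧-identityʳ; ∧-zeroʳ; ∨-identityʳ)
open import Data.Empty using (⊥; ⊥-elim)
open import Data.Fin
  using (Fin; zero; suc; _≟_; toℕ; fromℕ; fromℕ<; inject₁; inject≤; punchIn; combine; quotient; remainder)
open import Data.Fin.Permutation as Perm using (Permutation′; _⟨$⟩ʳ_; _∘ₚ_; transpose)
open import Data.Fin.Properties
  using ( suc-injective; toℕ-injective; toℕ<n; toℕ-fromℕ; toℕ-inject₁; inject₁-injective; toℕ-inject≤
        ; inject≤-injective; punchIn-injective; punchInᵢ≢i; remQuot-combine; combine-remQuot; toℕ-combine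
        ; combine-injectiveˡ; combine-injectiveʳ; <-cmp; any?; all?; injective⇒≤; pigeonhole )
open import Data.Fin.Relation.Unary.Top using (view; ‵fromℕ; ‵inject₁; view-inject₁; view-fromℕ)
open import Data.List using (List; _∷_; length; lookup; map; tabulate; allFin; cartesianProduct)
open import Data.List.Properties using (length-tabulate)
open import Data.List.Membership.Propositional using (_∈_; _∉_)
open import Data.List.Membership.Propositional.Properties
  using ( ∈-lookup; ∈-map⁺; ∈-map⁻; ∈-filter⁺; ∈-filter⁻; ∈-cartesianProduct⁺; ∈-allFin
        ; ∈-tabulate⁺; ∈-tabulate⁻; ∈-deduplicate⁺; ∈-deduplicate⁻ )
import Data.List.Relation.Unary.All as All
import Data.List.Relation.Unary.Any as Any
open import Data.List.Relation.Unary.Any.Properties using (lookup-index)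
open import Data.List.Relation.Unary.AllPairs using (_∷_)
open import Data.List.Relation.Unary.Unique.Propositional using (Unique)
open import Data.List.Relation.Unary.Unique.Propositional.Properties using (tabulate⁺)
open import Data.Nat using (ℕ; zero; suc; _+_; _*_; _≤_; _<_; _⊔_; _≡ᵇ_; _<ᵇ_; s≤s; z≤n)
import Data.Nat.Properties as ℕ
open import Data.List.Membership.DecPropositional ℕ._≟_ using (_∈?_)
open import Data.List.Relation.Unary.Unique.DecPropositional.Properties ℕ._≟_ using (deduplicate-!)
open import Data.Product using (Σ; ∃; ∃₂; _×_; _,_; proj₁; proj₂)
open import Data.Sum as Sum using (_⊎_; inj₁; inj₂; [_,_])
import Data.Vec.Functional as Vec
open import Function using (_∘_; case_of_)
open import Function.Bundles using (_↔_; Inverse; Injection)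
open import Function.Construct.Symmetry using (↔-sym)
open import Function.Definitions using (Injective)
open import Function.Properties.Inverse using (↔⇒↣)
open import Relation.Binary.Bundles using (Preorder)
open import Relation.Binary.Definitions using (tri<; tri≈; tri>)
open import Relation.Binary.PropositionalEquality as ≡
  using (_≡_; _≢_; refl; sym; trans; cong; cong₂; subst; subst₂; module ≡-Reasoning)
import Relation.Binary.Reasoning.Preorder
open import Relation.Binary.Structures using (IsPreorder)
open import Relation.Nullary using (¬_; ¬?; Dec; yes; no; does; _×-dec_; _⊎-dec_; _→-dec_)
open import Relation.Nullary.Decidable using (dec-true; dec-false; decidable-stable; T?)
open import Relation.Nullary.Negation using (contradiction)

↔-injective : ∀ {A B : Set} (φ : A ↔ B) → Injective _≡_ _≡_ (Inverse.to φ)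
↔-injective φ = Injection.injective (↔⇒↣ φ)

record Embedding (H₁ H₂ : Graph) : Set where
  field
    embed           : Fin (order H₁) → Fin (order H₂)
    embed-injective : Injective _≡_ _≡_ embed
    embed-adj       : ∀ u v → adj H₁ u v ≡ true → adj H₂ (embed u) (embed v) ≡ true
open Embedding

≅-sym : ∀ {H G} → H ≅ G → G ≅ H
≅-sym {H} {G} (φ , φ-adj) = ↔-sym φ , λ i j → adj-from
  where
  open Inverse φ
  adj-from : ∀ {i j} → adj H (from i) (from j) ≡ adj G i j
  adj-from {i} {j} = trans (sym (φ-adj (from i) (from j)))
                           (cong₂ (adj G) (strictlyInverseˡ i) (strictlyInverseˡ j))

≅⇒Embedding : ∀ {H G} → H ≅ G → Embedding H G
≅⇒Embedding (φ , φ-adj) = record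
  { embed           = Inverse.to φ
  ; embed-injective = ↔-injective φ
  ; embed-adj       = λ u v a → trans (φ-adj u v) a
  }

RainbowCopy-pullback : ∀ {H₁ H₂ n} {c : Coloring n} →
  Embedding H₁ H₂ → RainbowCopy H₂ c → RainbowCopy H₁ c
RainbowCopy-pullback e (f , f-injective , rainbow) =
  (λ x → f (embed e x)) , (λ eq → embed-injective e (f-injective eq)) ,
  λ u v u' v' a a' ¬same → rainbow _ _ _ _ (embed-adj e u v a) (embed-adj e u' v' a') (λ same → ¬same (reflect same))
  where
  reflect : ∀ {u v u' v'} → SameEdge (embed e u) (embed e v) (embed e u') (embed e v') → SameEdge u v u' v'
  reflect (inj₁ (p , q)) = inj₁ (embed-injective e p , embed-injective e q)
  reflect (inj₂ (p , q)) = inj₂ (embed-injective e p , embed-injective e q)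

Embedding⇒≼ : ∀ {H₁ H₂} → Embedding H₁ H₂ → H₁ ≼ H₂
Embedding⇒≼ e = 1 , ℕ.≤-refl , λ n c _ free copy → free (RainbowCopy-pullback {c = c} e copy)

≼-refl : ∀ {H} → H ≼ H
≼-refl = 1 , ℕ.≤-refl , λ _ _ _ free → free

≼-trans : ∀ {H₁ H₂ H₃} → H₁ ≼ H₂ → H₂ ≼ H₃ → H₁ ≼ H₃
≼-trans (t₁ , 1≤t₁ , h₁) (t₂ , _ , h₂) =
  t₁ ⊔ t₂ , ℕ.≤-trans 1≤t₁ (ℕ.m≤m⊔n t₁ t₂) ,
  λ n c t≤ free → h₂ n c (ℕ.≤-trans (ℕ.m≤n⊔m t₁ t₂) t≤)
                          (h₁ n c (ℕ.≤-trans (ℕ.m≤m⊔n t₁ t₂) t≤) free)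

≼-isPreorder : IsPreorder _≡_ _≼_
≼-isPreorder = record
  { isEquivalence = ≡.isEquivalence
  ; reflexive     = λ { {H} refl → ≼-refl {H} }
  ; trans         = λ {H₁} {H₂} {H₃} → ≼-trans {H₁} {H₂} {H₃}
  }

≼-preorder : Preorder _ _ _
≼-preorder = record { isPreorder = ≼-isPreorder }

module ≼-Reasoning = Relation.Binary.Reasoning.Preorder ≼-preorder

≅⇒≈ᵍ : ∀ {H G} → H ≅ G → H ≈ᵍ G
≅⇒≈ᵍ {H} {G} iso =
  Embedding⇒≼ (≅⇒Embedding {H} {G} iso) , Embedding⇒≼ (≅⇒Embedding {G} {H} (≅-sym {H} {G} iso))

-- Recognising stars and subdivided stars

_==_ : ∀ {n} → Fin n → Fin n → Bool
x == y = does (x ≟ y)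

==-refl : ∀ {n} (x : Fin n) → (x == x) ≡ true
==-refl x = dec-true (x ≟ x) refl

==-≢ : ∀ {n} {x y : Fin n} → x ≢ y → (x == y) ≡ false
==-≢ = dec-false (_ ≟ _)

==-injective : ∀ {m n} {f : Fin m → Fin n} → Injective _≡_ _≡_ f → ∀ x y → (f x == f y) ≡ (x == y)
==-injective {f = f} f-injective x y with x ≟ y
... | yes refl = ==-refl (f x)
... | no x≢y   = ==-≢ (x≢y ∘ f-injective)

starPattern : ∀ {n} → Fin n → Fin n → Fin n → Bool
starPattern w x y = (x == w) xor (y == w)

-- Adjacency in the subdivided star with centre w, subdivided leaf a and pendant vertex b.
plusPattern : ∀ {n} → Fin n → Fin n → Fin n → Fin n → Fin n → Bool
plusPattern w a b x y =
    (x == w ∧ not (y == w) ∧ not (y == b))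
  ∨ (y == w ∧ not (x == w) ∧ not (x == b))
  ∨ (x == a ∧ y == b)
  ∨ (x == b ∧ y == a)

starPattern-injective : ∀ {m n} {f : Fin m → Fin n} → Injective _≡_ _≡_ f →
  ∀ w x y → starPattern (f w) (f x) (f y) ≡ starPattern w x y
starPattern-injective f-inj w x y rewrite ==-injective f-inj x w | ==-injective f-inj y w = refl

plusPattern-injective : ∀ {m n} {f : Fin m → Fin n} → Injective _≡_ _≡_ f →
  ∀ w a b x y → plusPattern (f w) (f a) (f b) (f x) (f y) ≡ plusPattern w a b x y
plusPattern-injective f-inj w a b x y
  rewrite ==-injective f-inj x w | ==-injective f-inj y w | ==-injective f-inj x b
        | ==-injective f-inj y b | ==-injective f-inj x a | ==-injective f-inj y a = refl

record StarShape (H : Graph) (w : Fin (order H)) : Set where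
  field
    adj-centre   : ∀ u → u ≢ w → adj H u w ≡ true
    edge-centred : ∀ u v → adj H u v ≡ true → u ≢ w → v ≢ w → ⊥

record PlusShape (H : Graph) (w a b : Fin (order H)) : Set where
  field
    w≢a          : w ≢ a
    w≢b          : w ≢ b
    a≢b          : a ≢ b
    adj-ab       : adj H a b ≡ true
    nonadj-bw    : adj H b w ≡ false
    adj-centre   : ∀ u → u ≢ w → u ≢ b → adj H u w ≡ true
    edge-centred : ∀ u v → adj H u v ≡ true → u ≢ w → v ≢ w → SameEdge u v a b
open PlusShape

StarShape⇒starPattern : ∀ {H w} → StarShape H w → ∀ x y → adj H x y ≡ starPattern w x y
StarShape⇒starPattern {H} {w} shape x y with x ≟ w | y ≟ w
... | yes refl | yes refl = adj-irr H w
... | yes refl | no y≢w   = trans (adj-sym H w y) (StarShape.adj-centre shape y y≢w)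
... | no x≢w   | yes refl = StarShape.adj-centre shape x x≢w
... | no x≢w   | no y≢w with adj H x y in e
...   | true  = ⊥-elim (StarShape.edge-centred shape x y e x≢w y≢w)
...   | false = refl

==-∧-false : ∀ {n} {x a y b : Fin n} → ¬ (x ≡ a × y ≡ b) → (x == a ∧ y == b) ≡ false
==-∧-false {x = x} {a} {y} {b} ¬eq with x ≟ a | y ≟ b
... | yes refl | yes refl = ⊥-elim (¬eq (refl , refl))
... | yes _    | no _     = refl
... | no _     | _        = refl

PlusShape⇒plusPattern : ∀ {H w a b} → PlusShape H w a b → ∀ x y → adj H x y ≡ plusPattern w a b x y
PlusShape⇒plusPattern {H} {w} {a} {b} shape x y with x ≟ w | y ≟ w
... | yes refl | yes refl rewrite ==-≢ (w≢a shape) | ==-≢ (w≢b shape) = adj-irr H w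
... | yes refl | no y≢w with y ≟ b
...   | yes refl rewrite ==-≢ (w≢a shape) | ==-≢ (w≢b shape) = trans (adj-sym H w b) (nonadj-bw shape)
...   | no y≢b = trans (adj-sym H w y) (adj-centre shape y y≢w y≢b)
PlusShape⇒plusPattern {H} {w} {a} {b} shape x y | no x≢w | yes refl with x ≟ b
...   | yes refl rewrite ==-≢ (a≢b shape ∘ sym) | ==-≢ (w≢a shape) = nonadj-bw shape
...   | no x≢b = adj-centre shape x x≢w x≢b
PlusShape⇒plusPattern {H} {w} {a} {b} shape x y | no x≢w | no y≢w with adj H x y in e
...   | true with edge-centred shape x y e x≢w y≢w
...     | inj₁ (refl , refl) rewrite ==-refl a | ==-refl b = refl
...     | inj₂ (refl , refl) rewrite ==-refl a | ==-refl b | ==-≢ (a≢b shape ∘ sym) = refl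
PlusShape⇒plusPattern {H} {w} {a} {b} shape x y | no x≢w | no y≢w | false
  rewrite ==-∧-false {x = x} {a} {y} {b}
            (λ { (refl , refl) → contradiction (trans (sym (adj-ab shape)) e) λ () })
        | ==-∧-false {x = x} {b} {y} {a}
            (λ { (refl , refl) → contradiction (trans (sym (trans (adj-sym H b a) (adj-ab shape))) e) λ () })
  = refl

retarget : ∀ {n} → Permutation′ n → Fin n → Fin n → Permutation′ n
retarget π b r = π ∘ₚ transpose (π ⟨$⟩ʳ b) r

retarget-sends : ∀ {n} (π : Permutation′ n) (b r : Fin n) → retarget π b r ⟨$⟩ʳ b ≡ r
retarget-sends π b r rewrite dec-true (π ⟨$⟩ʳ b ≟ π ⟨$⟩ʳ b) refl = refl

retarget-keeps : ∀ {n} (π : Permutation′ n) {b r x : Fin n} → x ≢ b → π ⟨$⟩ʳ x ≢ r →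
  retarget π b r ⟨$⟩ʳ x ≡ π ⟨$⟩ʳ x
retarget-keeps π {b} {r} {x} x≢b πx≢r
  rewrite dec-false (π ⟨$⟩ʳ x ≟ π ⟨$⟩ʳ b) (x≢b ∘ ↔-injective π)
        | dec-false (π ⟨$⟩ʳ x ≟ r) πx≢r = refl

permutation-sending₃ : ∀ {n} {w a b p q r : Fin n} → w ≢ a → w ≢ b → a ≢ b → p ≢ q → p ≢ r → q ≢ r →
  Σ (Permutation′ n) λ π → π ⟨$⟩ʳ w ≡ p × π ⟨$⟩ʳ a ≡ q × π ⟨$⟩ʳ b ≡ r
permutation-sending₃ {w = w} {a} {b} {p} {q} {r} w≢a w≢b a≢b p≢q p≢r q≢r =
  π₃ , π₃w , π₃a , retarget-sends π₂ b r
  where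
  π₁ = retarget Perm.id w p
  π₂ = retarget π₁ a q
  π₃ = retarget π₂ b r
  π₁w = retarget-sends Perm.id w p
  π₂a = retarget-sends π₁ a q
  π₂w : π₂ ⟨$⟩ʳ w ≡ p
  π₂w = trans (retarget-keeps π₁ w≢a (p≢q ∘ trans (sym π₁w))) π₁w
  π₃w : π₃ ⟨$⟩ʳ w ≡ p
  π₃w = trans (retarget-keeps π₂ w≢b (p≢r ∘ trans (sym π₂w))) π₂w
  π₃a : π₃ ⟨$⟩ʳ a ≡ q
  π₃a = trans (retarget-keeps π₂ a≢b (q≢r ∘ trans (sym π₂a))) π₂a

≅-fromStarShapes : ∀ {H G w w'} → StarShape H w → StarShape G w' →
  (π : Fin (order H) ↔ Fin (order G)) → Inverse.to π w ≡ w' → H ≅ G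
≅-fromStarShapes {H} {G} {w} {w'} shapeH shapeG π πw≡w' = π , λ x y → begin
  adj G (to x) (to y)              ≡⟨ StarShape⇒starPattern shapeG (to x) (to y) ⟩
  starPattern w' (to x) (to y)     ≡⟨ cong (λ v → starPattern v (to x) (to y)) (sym πw≡w') ⟩
  starPattern (to w) (to x) (to y) ≡⟨ starPattern-injective (↔-injective π) w x y ⟩
  starPattern w x y                ≡⟨ StarShape⇒starPattern shapeH x y ⟨
  adj H x y                        ∎
  where
  open Inverse π
  open ≡-Reasoning

≅-fromPlusShapes : ∀ {H G w a b w' a' b'} → PlusShape H w a b → PlusShape G w' a' b' →
  (π : Fin (order H) ↔ Fin (order G)) →
  Inverse.to π w ≡ w' → Inverse.to π a ≡ a' → Inverse.to π b ≡ b' → H ≅ G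
≅-fromPlusShapes {H} {G} {w} {a} {b} {w'} {a'} {b'} shapeH shapeG π πw πa πb = π , λ x y → begin
  adj G (to x) (to y)                            ≡⟨ PlusShape⇒plusPattern shapeG (to x) (to y) ⟩
  plusPattern w' a' b' (to x) (to y)             ≡⟨ cong₃ (λ u v t → plusPattern u v t (to x) (to y)) πw πa πb ⟨
  plusPattern (to w) (to a) (to b) (to x) (to y) ≡⟨ plusPattern-injective (↔-injective π) w a b x y ⟩
  plusPattern w a b x y                          ≡⟨ PlusShape⇒plusPattern shapeH x y ⟨
  adj H x y                                      ∎
  where
  open Inverse π
  open ≡-Reasoning
  cong₃ : ∀ (f : _ → _ → _ → Bool) {u u' v v' t t'} → u ≡ u' → v ≡ v' → t ≡ t' → f u v t ≡ f u' v' t'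
  cong₃ f refl refl refl = refl

K1-starShape : ∀ m → StarShape (K1 m) zero
K1-starShape m = record
  { adj-centre   = λ { zero 0≢0 → contradiction refl 0≢0 ; (suc _) _ → refl }
  ; edge-centred = λ { zero _ _ 0≢0 _ → 0≢0 refl ; (suc _) zero _ _ 0≢0 → 0≢0 refl ; (suc _) (suc _) () }
  }

StarShape⇒≅K1 : ∀ {H w} → StarShape H w → Σ ℕ λ m → H ≅ K1 m
StarShape⇒≅K1 {record { order = suc m }} {w} shape =
  m , ≅-fromStarShapes shape (K1-starShape m) π (retarget-sends Perm.id w zero)
  where π = retarget Perm.id w zero

K1↪K1suc : ∀ k → Embedding (K1 k) (K1 (suc k))
K1↪K1suc k = record { embed = inject₁ ; embed-injective = inject₁-injective ; embed-adj = preserved }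
  where
  preserved : ∀ u v → adj (K1 k) u v ≡ true → adj (K1 (suc k)) (inject₁ u) (inject₁ v) ≡ true
  preserved zero    (suc _) _ = refl
  preserved (suc _) zero    _ = refl

<ᵇ-true : ∀ {m n} → m < n → (m <ᵇ n) ≡ true
<ᵇ-true {m} {n} = dec-true (m ℕ.<? n)

<ᵇ-irrefl : ∀ n → (n <ᵇ n) ≡ false
<ᵇ-irrefl n = dec-false (n ℕ.<? n) (ℕ.<-irrefl refl)

≡ᵇ-refl : ∀ n → (n ≡ᵇ n) ≡ true
≡ᵇ-refl n = dec-true (n ℕ.≟ n) refl

≡ᵇ-false : ∀ {m n} → m ≢ n → (m ≡ᵇ n) ≡ false
≡ᵇ-false {m} {n} = dec-false (m ℕ.≟ n)

-- K1plus (suc m) is K1 (suc m) on the vertices inject₁ x, plus the vertex top joined to vertex 1.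
top : ∀ {m} → Fin (suc (suc (suc m)))
top {m} = fromℕ (suc (suc m))

plusRel-below : ∀ {m x y} → y < suc (suc m) → plusRel m x y ≡ starRel x y
plusRel-below {m} {x} {y} y<
  rewrite <ᵇ-true y< | ≡ᵇ-false (ℕ.<⇒≢ y<)
        | ∧-identityʳ (not (y ≡ᵇ 0)) | ∧-zeroʳ (x ≡ᵇ 1) | ∨-identityʳ ((x ≡ᵇ 0) ∧ not (y ≡ᵇ 0)) = refl

adj-K1plus-inject₁ : ∀ {m} (x y : Fin (suc (suc m))) →
  adj (K1plus (suc m)) (inject₁ x) (inject₁ y) ≡ adj (K1 (suc m)) x y
adj-K1plus-inject₁ {m} x y rewrite toℕ-inject₁ x | toℕ-inject₁ y =
  cong₂ _∨_ (plusRel-below {m} {toℕ x} (toℕ<n y)) (plusRel-below {m} {toℕ y} (toℕ<n x))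

adj-K1plus-top : ∀ {m} (x : Fin (suc (suc m))) → adj (K1plus (suc m)) (inject₁ x) top ≡ (toℕ x ≡ᵇ 1)
adj-K1plus-top {m} x rewrite toℕ-inject₁ x | toℕ-fromℕ m | <ᵇ-irrefl m | ≡ᵇ-refl m
  | ∧-zeroʳ (toℕ x ≡ᵇ 0) | ∧-identityʳ (toℕ x ≡ᵇ 1) | ∨-identityʳ (toℕ x ≡ᵇ 1) = refl

toℕ≡ᵇ1 : ∀ {m} (x : Fin (suc (suc m))) → (toℕ x ≡ᵇ 1) ≡ true → x ≡ suc zero
toℕ≡ᵇ1 (suc zero) _ = refl

data K1plusEdge {m} : Fin (suc (suc (suc m))) → Fin (suc (suc (suc m))) → Set where
  starEdge : ∀ {x y} → adj (K1 (suc m)) x y ≡ true → K1plusEdge (inject₁ x) (inject₁ y)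
  pendant  : K1plusEdge (suc zero) top
  pendant′ : K1plusEdge top (suc zero)

K1plus-edge : ∀ {m} u v → adj (K1plus (suc m)) u v ≡ true → K1plusEdge u v
K1plus-edge {m} u v e with view u | view v
... | ‵fromℕ     | ‵fromℕ     = contradiction (trans (sym e) (adj-irr (K1plus (suc m)) top)) λ ()
... | ‵inject₁ x | ‵inject₁ y = starEdge (trans (sym (adj-K1plus-inject₁ x y)) e)
... | ‵inject₁ x | ‵fromℕ     with refl ← toℕ≡ᵇ1 x (trans (sym (adj-K1plus-top x)) e) = pendant
... | ‵fromℕ     | ‵inject₁ y
  with refl ← toℕ≡ᵇ1 y (trans (sym (adj-K1plus-top y)) (trans (adj-sym (K1plus (suc m)) (inject₁ y) top) e)) = pendant′

K1plus-plusShape : ∀ m → PlusShape (K1plus (suc m)) zero (suc zero) top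
K1plus-plusShape m = record
  { w≢a          = λ ()
  ; w≢b          = λ ()
  ; a≢b          = λ ()
  ; adj-ab       = adj-K1plus-top {m} (suc zero)
  ; nonadj-bw    = trans (adj-sym (K1plus (suc m)) top zero) (adj-K1plus-top {m} zero)
  ; adj-centre   = adjacent
  ; edge-centred = centred
  }
  where
  adjacent : ∀ u → u ≢ zero → u ≢ top → adj (K1plus (suc m)) u zero ≡ true
  adjacent u u≢0 u≢top with view u
  ... | ‵fromℕ                = contradiction refl u≢top
  ... | ‵inject₁ zero         = contradiction refl u≢0
  ... | ‵inject₁ x@(suc _)    = adj-K1plus-inject₁ x zero
  centred : ∀ u v → adj (K1plus (suc m)) u v ≡ true → u ≢ zero → v ≢ zero → SameEdge u v (suc zero) top
  centred u v e u≢0 v≢0 with K1plus-edge u v e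
  ... | starEdge {zero}  _           = contradiction refl u≢0
  ... | starEdge {suc _} {zero} _    = contradiction refl v≢0
  ... | pendant                      = inj₁ (refl , refl)
  ... | pendant′                     = inj₂ (refl , refl)

K1↪K1plus : ∀ m → Embedding (K1 (suc m)) (K1plus (suc m))
K1↪K1plus m = record
  { embed           = inject₁
  ; embed-injective = inject₁-injective
  ; embed-adj       = λ u v e → trans (adj-K1plus-inject₁ u v) e
  }

Fin2-noThreeDistinct : {x y z : Fin 2} → x ≢ y → x ≢ z → y ≢ z → ⊥
Fin2-noThreeDistinct {zero}     {zero}     x≢y _   _   = x≢y refl
Fin2-noThreeDistinct {suc zero} {suc zero} x≢y _   _   = x≢y refl
Fin2-noThreeDistinct {zero}     {suc zero} {zero}     _ x≢z _   = x≢z refl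
Fin2-noThreeDistinct {zero}     {suc zero} {suc zero} _ _   y≢z = y≢z refl
Fin2-noThreeDistinct {suc zero} {zero}     {zero}     _ _   y≢z = y≢z refl
Fin2-noThreeDistinct {suc zero} {zero}     {suc zero} _ x≢z _   = x≢z refl

PlusShape⇒≅K1plus : ∀ {H w a b} → PlusShape H w a b → Σ ℕ λ m → H ≅ K1plus (suc m)
PlusShape⇒≅K1plus {record { order = 1 }} {zero} {zero} shape = contradiction refl (w≢a shape)
PlusShape⇒≅K1plus {record { order = 2 }} shape =
  ⊥-elim (Fin2-noThreeDistinct (w≢a shape) (w≢b shape) (a≢b shape))
PlusShape⇒≅K1plus {record { order = suc (suc (suc m)) }} shape =
  let target = K1plus-plusShape m
      (π , πw , πa , πb) = permutation-sending₃ (w≢a shape) (w≢b shape) (a≢b shape)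
                                               (w≢a target) (w≢b target) (a≢b target)
  in m , ≅-fromPlusShapes shape target π πw πa πb

record RainbowStar {n} (c : Coloring n) (r : ℕ) : Set where
  field
    centre          : Fin n
    leaf            : Fin r → Fin n
    leaf≢centre     : ∀ i → leaf i ≢ centre
    spoke-injective : Injective _≡_ _≡_ (λ i → col c centre (leaf i))
open RainbowStar

module _ {n} {c : Coloring n} where

  spoke : ∀ {r} → RainbowStar c r → Fin r → ℕ
  spoke st i = col c (centre st) (leaf st i)

  leaf-injective : ∀ {r} (st : RainbowStar c r) → Injective _≡_ _≡_ (leaf st)
  leaf-injective st = spoke-injective st ∘ cong (col c (centre st))

  vertex : ∀ {r} → RainbowStar c r → Fin (suc r) → Fin n
  vertex st = centre st Vec.∷ leaf st

  vertex-injective : ∀ {r} (st : RainbowStar c r) → Injective _≡_ _≡_ (vertex st)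
  vertex-injective st {zero}  {zero}  _  = refl
  vertex-injective st {zero}  {suc j} eq = contradiction (sym eq) (leaf≢centre st j)
  vertex-injective st {suc i} {zero}  eq = contradiction eq (leaf≢centre st i)
  vertex-injective st {suc i} {suc j} eq = cong suc (leaf-injective st eq)

data K1Edge {r} : Fin (suc r) → Fin (suc r) → Set where
  outward : ∀ i → K1Edge zero (suc i)
  inward  : ∀ i → K1Edge (suc i) zero

K1-edge : ∀ {r} u v → adj (K1 r) u v ≡ true → K1Edge u v
K1-edge zero    (suc i) _ = outward i
K1-edge (suc i) zero    _ = inward i

edgeLeaf : ∀ {r} {u v : Fin (suc r)} → K1Edge u v → Fin r
edgeLeaf (outward i) = i
edgeLeaf (inward i)  = i

module _ {n} {c : Coloring n} {r} (st : RainbowStar c r) where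

  edge-spoke : ∀ {u v} (e : K1Edge u v) → col c (vertex st u) (vertex st v) ≡ spoke st (edgeLeaf e)
  edge-spoke (outward i) = refl
  edge-spoke (inward i)  = col-sym c _ _

  sameColour⇒SameEdge : ∀ u v u' v' → adj (K1 r) u v ≡ true → adj (K1 r) u' v' ≡ true →
    col c (vertex st u) (vertex st v) ≡ col c (vertex st u') (vertex st v') → SameEdge u v u' v'
  sameColour⇒SameEdge u v u' v' a a' eq =
    sameLeaf (K1-edge u v a) (K1-edge u' v' a')
      (spoke-injective st (trans (sym (edge-spoke (K1-edge u v a))) (trans eq (edge-spoke (K1-edge u' v' a')))))
    where
    sameLeaf : ∀ {u v u' v'} (e : K1Edge u v) (e' : K1Edge u' v') → edgeLeaf e ≡ edgeLeaf e' → SameEdge u v u' v'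
    sameLeaf (outward i) (outward _) refl = inj₁ (refl , refl)
    sameLeaf (outward i) (inward _)  refl = inj₂ (refl , refl)
    sameLeaf (inward i)  (outward _) refl = inj₂ (refl , refl)
    sameLeaf (inward i)  (inward _)  refl = inj₁ (refl , refl)

RainbowStar⇒RainbowCopy : ∀ {n r} {c : Coloring n} → RainbowStar c r → RainbowCopy (K1 r) c
RainbowStar⇒RainbowCopy st =
  vertex st , vertex-injective st , λ u v u' v' a a' ¬same eq → ¬same (sameColour⇒SameEdge st u v u' v' a a' eq)

RainbowCopy⇒RainbowStar : ∀ {n r} {c : Coloring n} → RainbowCopy (K1 r) c → RainbowStar c r
RainbowCopy⇒RainbowStar {c = c} (f , f-injective , rainbow) = record
  { centre          = f zero
  ; leaf            = f ∘ suc
  ; leaf≢centre     = λ i → (λ ()) ∘ f-injective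
  ; spoke-injective = λ {i} {j} eq → decidable-stable (i ≟ j) λ i≢j →
      rainbow zero (suc i) zero (suc j) refl refl
        (λ { (inj₁ (_ , e)) → i≢j (suc-injective e) ; (inj₂ (() , _)) }) eq
  }

addLeaf : ∀ {n r} {c : Coloring n} (st : RainbowStar c r) (y : Fin n) → y ≢ centre st →
  (∀ i → col c (centre st) y ≢ spoke st i) → RainbowStar c (suc r)
addLeaf {c = c} st y y≢centre fresh = record
  { centre          = centre st
  ; leaf            = (y Vec.∷ leaf st)
  ; leaf≢centre     = λ { zero → y≢centre ; (suc i) → leaf≢centre st i }
  ; spoke-injective = spokes-injective
  }
  where
  spokes-injective : Injective _≡_ _≡_ (λ i → col c (centre st) ((y Vec.∷ leaf st) i))
  spokes-injective {zero}  {zero}  _  = refl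
  spokes-injective {zero}  {suc j} eq = contradiction eq (fresh j)
  spokes-injective {suc i} {zero}  eq = contradiction (sym eq) (fresh i)
  spokes-injective {suc i} {suc j} eq = cong suc (spoke-injective st eq)

restrict : ∀ {n r r'} {c : Coloring n} (st : RainbowStar c r) (ι : Fin r' → Fin r) → Injective _≡_ _≡_ ι →
  RainbowStar c r'
restrict st ι ι-injective = record
  { centre          = centre st
  ; leaf            = leaf st ∘ ι
  ; leaf≢centre     = leaf≢centre st ∘ ι
  ; spoke-injective = ι-injective ∘ spoke-injective st
  }

SameEdge-map : ∀ {m n} (g : Fin m → Fin n) {u v u' v'} → SameEdge u v u' v' → SameEdge (g u) (g v) (g u') (g v')
SameEdge-map g (inj₁ (refl , refl)) = inj₁ (refl , refl)
SameEdge-map g (inj₂ (refl , refl)) = inj₂ (refl , refl)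

extend : ∀ {k} {A : Set} → (Fin k → A) → A → Fin (suc k) → A
extend g a u with view u
... | ‵fromℕ     = a
... | ‵inject₁ x = g x

extend-inject₁ : ∀ {k} {A : Set} {g : Fin k → A} {a} x → extend g a (inject₁ x) ≡ g x
extend-inject₁ x rewrite view-inject₁ x = refl

extend-fromℕ : ∀ {k} {A : Set} {g : Fin k → A} {a} → extend g a (fromℕ k) ≡ a
extend-fromℕ {k} rewrite view-fromℕ k = refl

RainbowStar⇒K1plusCopy : ∀ {n m} {c : Coloring n} (st : RainbowStar c (suc m)) (p : Fin n) →
  (∀ x → vertex st x ≢ p) → (∀ i → col c (leaf st zero) p ≢ spoke st i) → RainbowCopy (K1plus (suc m)) c
RainbowStar⇒K1plusCopy {m = m} {c} st p p-fresh colour-fresh = f , f-injective , rainbow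
  where
  f : Fin (suc (suc (suc m))) → _
  f = extend (vertex st) p
  f-injective : Injective _≡_ _≡_ f
  f-injective {u} {v} eq with view u | view v
  ... | ‵fromℕ     | ‵fromℕ     = refl
  ... | ‵inject₁ x | ‵inject₁ y = cong inject₁ (vertex-injective st eq)
  ... | ‵inject₁ x | ‵fromℕ     = contradiction eq (p-fresh x)
  ... | ‵fromℕ     | ‵inject₁ y = contradiction (sym eq) (p-fresh y)
  star-colour : ∀ x y → col c (f (inject₁ x)) (f (inject₁ y)) ≡ col c (vertex st x) (vertex st y)
  star-colour x y = cong₂ (col c) (extend-inject₁ x) (extend-inject₁ y)
  pendant-colour : col c (f (suc zero)) (f top) ≡ col c (leaf st zero) p
  pendant-colour =
    cong₂ (col c) (extend-inject₁ {g = vertex st} {a = p} (suc zero)) (extend-fromℕ {g = vertex st} {a = p})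
  clash : ∀ x y → adj (K1 (suc m)) x y ≡ true → col c (vertex st x) (vertex st y) ≢ col c (leaf st zero) p
  clash x y a eq = colour-fresh (edgeLeaf e) (trans (sym eq) (edge-spoke st e))
    where e = K1-edge x y a
  rainbow : ∀ u v u' v' → adj (K1plus (suc m)) u v ≡ true → adj (K1plus (suc m)) u' v' ≡ true →
    ¬ SameEdge u v u' v' → col c (f u) (f v) ≢ col c (f u') (f v')
  rainbow u v u' v' a a' ¬same eq with K1plus-edge u v a | K1plus-edge u' v' a'
  ... | starEdge {x} {y} s | starEdge {x'} {y'} s' = ¬same (SameEdge-map inject₁
          (sameColour⇒SameEdge st x y x' y' s s' (trans (sym (star-colour x y)) (trans eq (star-colour x' y')))))
  ... | starEdge {x} {y} s | pendant     = clash x y s (trans (sym (star-colour x y)) (trans eq pendant-colour))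
  ... | starEdge {x} {y} s | pendant′    =
    clash x y s (trans (sym (star-colour x y)) (trans eq (trans (col-sym c _ _) pendant-colour)))
  ... | pendant  | starEdge {x} {y} s = clash x y s (trans (sym (star-colour x y)) (trans (sym eq) pendant-colour))
  ... | pendant′ | starEdge {x} {y} s =
    clash x y s (trans (sym (star-colour x y)) (trans (sym eq) (trans (col-sym c _ _) pendant-colour)))
  ... | pendant    | pendant     = ¬same (inj₁ (refl , refl))
  ... | pendant    | pendant′    = ¬same (inj₂ (refl , refl))
  ... | pendant′   | pendant     = ¬same (inj₂ (refl , refl))
  ... | pendant′   | pendant′    = ¬same (inj₁ (refl , refl))

lookup-injective : ∀ {A : Set} {xs : List A} → Unique xs → Injective _≡_ _≡_ (lookup xs)
lookup-injective {xs = _ ∷ _} (_   ∷ _) {zero}  {zero}  _  = refl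
lookup-injective {xs = _ ∷ _} (x∉ ∷ _) {zero}  {suc j} eq = contradiction eq (All.lookup x∉ (∈-lookup j))
lookup-injective {xs = _ ∷ _} (x∉ ∷ _) {suc i} {zero}  eq = contradiction (sym eq) (All.lookup x∉ (∈-lookup i))
lookup-injective {xs = _ ∷ _} (_  ∷ u) {suc i} {suc j} eq = cong suc (lookup-injective u eq)

Unique⊆⇒length≤ : ∀ {A : Set} {xs ys : List A} → Unique xs → (∀ {x} → x ∈ xs → x ∈ ys) →
  length xs ≤ length ys
Unique⊆⇒length≤ {xs = xs} {ys} unique xs⊆ys = injective⇒≤ {f = position} position-injective
  where
  position : Fin (length xs) → Fin (length ys)
  position i = Any.index (xs⊆ys (∈-lookup i))
  position-injective : Injective _≡_ _≡_ position
  position-injective {i} {j} eq = lookup-injective unique (begin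
    lookup xs i              ≡⟨ lookup-index (xs⊆ys (∈-lookup i)) ⟩
    lookup ys (position i)   ≡⟨ cong (lookup ys) eq ⟩
    lookup ys (position j)   ≡⟨ lookup-index (xs⊆ys (∈-lookup j)) ⟨
    lookup xs j              ∎)
    where open ≡-Reasoning

colours : ∀ {n} → Coloring n → List ℕ
colours {n} c = map (λ e → col c (proj₁ e) (proj₂ e)) (edgesK n)

edge∈edgesK : ∀ {n} {i j : Fin n} → toℕ i < toℕ j → (i , j) ∈ edgesK n
edge∈edgesK {i = i} {j} i<j = ∈-filter⁺ (T? ∘ _) (∈-cartesianProduct⁺ (∈-allFin i) (∈-allFin j)) (ℕ.<⇒<ᵇ i<j)

edgesK-irreflexive : ∀ {n} {i j : Fin n} → (i , j) ∈ edgesK n → i ≢ j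
edgesK-irreflexive {n} {i} e refl =
  ℕ.<-irrefl refl (ℕ.<ᵇ⇒< (toℕ i) (toℕ i)
    (proj₂ (∈-filter⁻ (T? ∘ _) {xs = cartesianProduct (allFin n) (allFin n)} e)))

module _ {n} (c : Coloring n) where

  col∈colours : ∀ {i j} → i ≢ j → col c i j ∈ colours c
  col∈colours {i} {j} i≢j with <-cmp i j
  ... | tri< i<j _ _ = ∈-map⁺ _ (edge∈edgesK i<j)
  ... | tri≈ _ i≡j _ = contradiction i≡j i≢j
  ... | tri> _ _ j<i = subst (_∈ colours c) (col-sym c _ _) (∈-map⁺ _ (edge∈edgesK j<i))

  ∈colours⇒col : ∀ {x} → x ∈ colours c → ∃₂ λ i j → i ≢ j × x ≡ col c i j
  ∈colours⇒col x∈ with ∈-map⁻ _ x∈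
  ... | (i , j) , e , refl = i , j , edgesK-irreflexive e , refl

  numColors-≥ : ∀ {T} (g : Fin T → ℕ) → Injective _≡_ _≡_ g → (∀ a → g a ∈ colours c) → T ≤ numColors c
  numColors-≥ {T} g g-injective g∈ = subst (_≤ numColors c) (length-tabulate g)
    (Unique⊆⇒length≤ (tabulate⁺ g-injective) λ x∈ →
      case ∈-tabulate⁻ x∈ of λ { (a , refl) → ∈-deduplicate⁺ ℕ._≟_ (g∈ a) })

  numColors-≤ : (xs : List ℕ) → (∀ {i j} → i ≢ j → col c i j ∈ xs) → numColors c ≤ length xs
  numColors-≤ xs col∈ = Unique⊆⇒length≤ (deduplicate-! (colours c)) λ x∈ →
    case ∈colours⇒col (∈-deduplicate⁻ ℕ._≟_ (colours c) x∈) of λ { (i , j , i≢j , refl) → col∈ i≢j }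

  colour-outside : (xs : List ℕ) → length xs < numColors c → ∃₂ λ i j → i ≢ j × col c i j ∉ xs
  colour-outside xs xs<
    with any? (λ i → any? λ j → ¬? (i ≟ j) ×-dec ¬? (col c i j ∈? xs))
  ... | yes (i , j , found) = i , j , found
  ... | no none = contradiction (numColors-≤ xs λ {i} {j} i≢j →
          decidable-stable (col c i j ∈? xs) λ ∉ → none (i , j , i≢j , ∉)) (ℕ.<⇒≱ xs<)

-- Connected graphs below a star

colouringOf : ∀ n (κ : ℕ → ℕ → ℕ) → (∀ x y → κ x y ≡ κ y x) → Coloring n
colouringOf n κ κ-sym = record
  { col     = λ i j → κ (toℕ i) (toℕ j)
  ; col-sym = λ i j → κ-sym (toℕ i) (toℕ j)
  }

module Fan (N : ℕ) (κ : ℕ → ℕ → ℕ) (κ-sym : ∀ x y → κ x y ≡ κ y x) (κ-fan : ∀ y → κ 0 y ≡ y) where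

  fan : Coloring (suc N)
  fan = colouringOf (suc N) κ κ-sym

  fan-numColors : N ≤ numColors fan
  fan-numColors = numColors-≥ fan (λ a → suc (toℕ a)) (toℕ-injective ∘ ℕ.suc-injective)
    λ a → subst (_∈ colours fan) (κ-fan (suc (toℕ a))) (col∈colours fan {zero} {suc a} λ ())

  fan-star : ∀ {m} → m ≤ N → RainbowStar fan m
  fan-star m≤N = record
    { centre          = zero
    ; leaf            = λ i → suc (inject≤ i m≤N)
    ; leaf≢centre     = λ i ()
    ; spoke-injective = λ {i} {j} eq → toℕ-injective (begin
        toℕ i                     ≡⟨ toℕ-inject≤ i m≤N ⟨
        toℕ (inject≤ i m≤N)       ≡⟨ ℕ.suc-injective (trans (sym (κ-fan _)) (trans eq (κ-fan _))) ⟩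
        toℕ (inject≤ j m≤N)       ≡⟨ toℕ-inject≤ j m≤N ⟩
        toℕ j                     ∎)
    }
    where open ≡-Reasoning

starColour : ℕ → ℕ → ℕ
starColour zero    y       = y
starColour (suc x) zero    = suc x
starColour (suc x) (suc y) = 0

starColour-sym : ∀ x y → starColour x y ≡ starColour y x
starColour-sym zero    zero    = refl
starColour-sym zero    (suc y) = refl
starColour-sym (suc x) zero    = refl
starColour-sym (suc x) (suc y) = refl

module StarFan N = Fan N starColour starColour-sym (λ _ → refl)
module MaxFan N = Fan N _⊔_ ℕ.⊔-comm (λ _ → refl)

EdgesAvoidingCoincide : (H : Graph) → Fin (order H) → Set
EdgesAvoidingCoincide H w = ∀ u v u' v' → adj H u v ≡ true → adj H u' v' ≡ true →
  u ≢ w → v ≢ w → u' ≢ w → v' ≢ w → SameEdge u v u' v'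

TriangleFree : Graph → Set
TriangleFree H = ∀ u v w → adj H u v ≡ true → adj H v w ≡ true → adj H u w ≡ true → ⊥

adj⇒≢ : ∀ H {u v} → adj H u v ≡ true → u ≢ v
adj⇒≢ H {u} e refl = contradiction (trans (sym e) (adj-irr H u)) λ ()

SameEdge? : ∀ {m} (u v u' v' : Fin m) → Dec (SameEdge u v u' v')
SameEdge? u v u' v' = ((u ≟ u') ×-dec (v ≟ v')) ⊎-dec ((u ≟ v') ×-dec (v ≟ u'))

-- All edges of the star colouring that avoid vertex 0 share colour 0.
starFan-avoiding : ∀ {N H} ((f , _ , _) : RainbowCopy H (StarFan.fan N)) w → (∀ {x} → x ≢ w → f x ≢ zero) →
  EdgesAvoidingCoincide H w
starFan-avoiding {N} (f , _ , rainbow) w avoid u v u' v' a a' u≢w v≢w u'≢w v'≢w =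
  decidable-stable (SameEdge? u v u' v') λ ¬same →
    rainbow u v u' v' a a' ¬same (trans (colour0 (avoid u≢w) (avoid v≢w)) (sym (colour0 (avoid u'≢w) (avoid v'≢w))))
  where
  colour0 : ∀ {x y : Fin (suc N)} → x ≢ zero → y ≢ zero → starColour (toℕ x) (toℕ y) ≡ 0
  colour0 {zero}          x≢0 _   = contradiction refl x≢0
  colour0 {suc _} {zero}  _   y≢0 = contradiction refl y≢0
  colour0 {suc _} {suc _} _   _   = refl

starFan-copy⇒centre : ∀ {N H} → 1 ≤ order H → RainbowCopy H (StarFan.fan N) → ∃ (EdgesAvoidingCoincide H)
starFan-copy⇒centre {N} {H} 1≤order copy@(f , f-injective , _) with any? (λ u → f u ≟ zero)
... | yes (w , fw≡0) =
  w , starFan-avoiding {N} {H} copy w λ x≢w fx≡0 → x≢w (f-injective (trans fx≡0 (sym fw≡0)))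
... | no none =
  fromℕ< 1≤order , starFan-avoiding {N} {H} copy (fromℕ< 1≤order) λ {x} _ fx≡0 → none (x , fx≡0)

-- The two maxima involving the largest of x, y, z coincide.
⊔-twoEqual : ∀ x y z → (x ⊔ y ≡ x ⊔ z) ⊎ (x ⊔ y ≡ y ⊔ z) ⊎ (x ⊔ z ≡ y ⊔ z)
⊔-twoEqual x y z with ℕ.≤-total y x | ℕ.≤-total z x | ℕ.≤-total z y
... | inj₁ y≤x | inj₁ z≤x | _        = inj₁ (trans (ℕ.m≥n⇒m⊔n≡m y≤x) (sym (ℕ.m≥n⇒m⊔n≡m z≤x)))
... | inj₂ x≤y | _        | inj₁ z≤y = inj₂ (inj₁ (trans (ℕ.m≤n⇒m⊔n≡n x≤y) (sym (ℕ.m≥n⇒m⊔n≡m z≤y))))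
... | inj₁ y≤x | inj₂ x≤z | _        =
  inj₂ (inj₂ (trans (ℕ.m≤n⇒m⊔n≡n x≤z) (sym (ℕ.m≤n⇒m⊔n≡n (ℕ.≤-trans y≤x x≤z)))))
... | inj₂ x≤y | _        | inj₂ y≤z =
  inj₂ (inj₂ (trans (ℕ.m≤n⇒m⊔n≡n (ℕ.≤-trans x≤y y≤z)) (sym (ℕ.m≤n⇒m⊔n≡n y≤z))))

maxFan-copy⇒triangleFree : ∀ {N H} → RainbowCopy H (MaxFan.fan N) → TriangleFree H
maxFan-copy⇒triangleFree {H = H} (f , _ , rainbow) u v w uv vw uw
  with ⊔-twoEqual (toℕ (f u)) (toℕ (f v)) (toℕ (f w))
... | inj₁ eq        = rainbow u v u w uv uw
  (λ { (inj₁ (_ , v≡w)) → adj⇒≢ H vw v≡w ; (inj₂ (u≡w , _)) → adj⇒≢ H uw u≡w }) eq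
... | inj₂ (inj₁ eq) = rainbow u v v w uv vw
  (λ { (inj₁ (u≡v , _)) → adj⇒≢ H uv u≡v ; (inj₂ (u≡w , _)) → adj⇒≢ H uw u≡w }) eq
... | inj₂ (inj₂ eq) = rainbow u w v w uw vw
  (λ { (inj₁ (u≡v , _)) → adj⇒≢ H uv u≡v ; (inj₂ (u≡w , _)) → adj⇒≢ H uw u≡w }) eq

Reach⇒neighbour : ∀ {G u w} → Reach G u w → u ≢ w → ∃ λ v → adj G u v ≡ true
Reach⇒neighbour here       u≢w = contradiction refl u≢w
Reach⇒neighbour (step e _) _   = _ , e

Reach-closed : ∀ {G} (P : Fin (order G) → Set) → (∀ {u v} → P u → adj G u v ≡ true → P v) →
  ∀ {u w} → P u → Reach G u w → P w
Reach-closed P closed Pu here       = Pu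
Reach-closed P closed Pu (step e r) = Reach-closed P closed (closed Pu e) r

module _ {H : Graph} {w : Fin (order H)} (connected : Connected H) (coincide : EdgesAvoidingCoincide H w) where

  private
    neighbour : ∀ u → u ≢ w → ∃ λ v → adj H u v ≡ true
    neighbour u u≢w = Reach⇒neighbour (proj₂ connected u w) u≢w

  noAvoidingEdge⇒StarShape : (∀ a b → adj H a b ≡ true → a ≢ w → b ≢ w → ⊥) → StarShape H w
  noAvoidingEdge⇒StarShape none = record { adj-centre = adjacent ; edge-centred = none }
    where
    adjacent : ∀ u → u ≢ w → adj H u w ≡ true
    adjacent u u≢w with neighbour u u≢w
    ... | v , uv with v ≟ w
    ...   | yes refl = uv
    ...   | no v≢w   = ⊥-elim (none u v uv u≢w v≢w)

  avoidingEdge⇒PlusShape : ∀ {a b} → adj H a b ≡ true → a ≢ w → b ≢ w →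
    adj H a w ≡ true → adj H b w ≡ false → PlusShape H w a b
  avoidingEdge⇒PlusShape {a} {b} ab a≢w b≢w aw bw = record
    { w≢a          = a≢w ∘ sym
    ; w≢b          = b≢w ∘ sym
    ; a≢b          = adj⇒≢ H ab
    ; adj-ab       = ab
    ; nonadj-bw    = bw
    ; adj-centre   = adjacent
    ; edge-centred = λ u v uv u≢w v≢w → coincide u v a b uv ab u≢w v≢w a≢w b≢w
    }
    where
    adjacent : ∀ u → u ≢ w → u ≢ b → adj H u w ≡ true
    adjacent u u≢w u≢b with neighbour u u≢w
    ... | v , uv with v ≟ w
    ...   | yes refl = uv
    ...   | no v≢w with coincide u v a b uv ab u≢w v≢w a≢w b≢w
    ...     | inj₁ (refl , _) = aw
    ...     | inj₂ (u≡b , _)  = contradiction u≡b u≢b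

  -- The edge ab avoiding w is the only edge at a or b not leading to w, so {a, b} would be a component.
  avoidingEdge-reachesCentre : ∀ {a b} → adj H a b ≡ true → a ≢ w → b ≢ w →
    adj H a w ≡ false → adj H b w ≡ false → ⊥
  avoidingEdge-reachesCentre {a} {b} ab a≢w b≢w aw bw =
    [ a≢w ∘ sym , b≢w ∘ sym ] (Reach-closed (λ u → u ≡ a ⊎ u ≡ b) closed (inj₁ refl) (proj₂ connected a w))
    where
    closed : ∀ {u v} → u ≡ a ⊎ u ≡ b → adj H u v ≡ true → v ≡ a ⊎ v ≡ b
    closed {u} {v} u∈ab uv with v ≟ w | u∈ab
    ... | yes refl | inj₁ refl = contradiction (trans (sym uv) aw) λ ()
    ... | yes refl | inj₂ refl = contradiction (trans (sym uv) bw) λ ()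
    ... | no v≢w   | _
      with coincide u v a b uv ab ([ (λ { refl → a≢w }) , (λ { refl → b≢w }) ] u∈ab) v≢w a≢w b≢w
    ...   | inj₁ (_ , v≡b) = inj₂ v≡b
    ...   | inj₂ (_ , v≡a) = inj₁ v≡a

  centre⇒shape : TriangleFree H → StarShape H w ⊎ ∃₂ (PlusShape H w)
  centre⇒shape triangleFree
    with any? (λ a → any? λ b → (adj H a b Bool.≟ true) ×-dec ¬? (a ≟ w) ×-dec ¬? (b ≟ w))
  ... | no none = inj₁ (noAvoidingEdge⇒StarShape λ a b ab a≢w b≢w → none (a , b , ab , a≢w , b≢w))
  ... | yes (a , b , ab , a≢w , b≢w) with adj H a w in aw | adj H b w in bw
  ...   | true  | true  = ⊥-elim (triangleFree w a b (trans (adj-sym H w a) aw) ab (trans (adj-sym H w b) bw))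
  ...   | true  | false = inj₂ (a , b , avoidingEdge⇒PlusShape ab a≢w b≢w aw bw)
  ...   | false | true  = inj₂ (b , a , avoidingEdge⇒PlusShape (trans (adj-sym H b a) ab) b≢w a≢w bw aw)
  ...   | false | false = ⊥-elim (avoidingEdge-reachesCentre ab a≢w b≢w aw bw)

EdgesAvoidingCoincide? : ∀ H w → Dec (EdgesAvoidingCoincide H w)
EdgesAvoidingCoincide? H w = all? λ u → all? λ v → all? λ u' → all? λ v' →
  (adj H u v Bool.≟ true) →-dec (adj H u' v' Bool.≟ true) →-dec
  ¬? (u ≟ w) →-dec ¬? (v ≟ w) →-dec ¬? (u' ≟ w) →-dec ¬? (v' ≟ w) →-dec SameEdge? u v u' v'

≼K1⇒shape : ∀ {H k} → Connected H → H ≼ K1 k →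
  (Σ ℕ λ m → H ≅ K1 m) ⊎ (Σ ℕ λ m → H ≅ K1plus (suc m))
≼K1⇒shape {H} {k} connected (t , _ , upper) =
  [ inj₁ ∘ StarShape⇒≅K1 , inj₂ ∘ PlusShape⇒≅K1plus ∘ proj₂ ∘ proj₂ ]
    (centre⇒shape connected (proj₂ avoidedCentre) triangleFree)
  where
  N = t + k
  forcedCopy : (c : Coloring (suc N)) → t ≤ numColors c → RainbowStar c k → ¬ ¬ RainbowCopy H c
  forcedCopy c t≤ star free = upper (suc N) c t≤ free (RainbowStar⇒RainbowCopy star)
  starFanCopy : ¬ ¬ RainbowCopy H (StarFan.fan N)
  starFanCopy =
    forcedCopy _ (ℕ.≤-trans (ℕ.m≤m+n t k) (StarFan.fan-numColors N)) (StarFan.fan-star N (ℕ.m≤n+m k t))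
  maxFanCopy : ¬ ¬ RainbowCopy H (MaxFan.fan N)
  maxFanCopy =
    forcedCopy _ (ℕ.≤-trans (ℕ.m≤m+n t k) (MaxFan.fan-numColors N)) (MaxFan.fan-star N (ℕ.m≤n+m k t))
  avoidedCentre : ∃ (EdgesAvoidingCoincide H)
  avoidedCentre = decidable-stable (any? (EdgesAvoidingCoincide? H)) λ none →
    starFanCopy (none ∘ starFan-copy⇒centre {N} {H} (proj₁ connected))
  triangleFree : TriangleFree H
  triangleFree u v x uv vx ux = maxFanCopy λ copy → maxFan-copy⇒triangleFree {N} {H} copy u v x uv vx ux

-- Stars form a strictly increasing chain

-- K_n with n = (2 + T)(2 + s) split into 2 + T blocks of 2 + s consecutive vertices; an edge inside a
-- block gets colour 1 + (larger endpoint), an edge between blocks gets colour 0.  A vertex then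
-- sees only 2 + s colours, but there are at least T colours.
module Blocks (T s : ℕ) where

  Vertex : Set
  Vertex = Fin (suc (suc T) * suc (suc s))

  block : Vertex → Fin (suc (suc T))
  block = quotient (suc (suc s))

  position : Vertex → Fin (suc (suc s))
  position = remainder {suc (suc T)} (suc (suc s))

  at : Fin (suc (suc T)) → Fin (suc (suc s)) → Vertex
  at = combine

  at-injectiveˡ : ∀ β i β' i' → at β i ≡ at β' i' → β ≡ β'
  at-injectiveˡ = combine-injectiveˡ

  at-injectiveʳ : ∀ β i β' i' → at β i ≡ at β' i' → i ≡ i'
  at-injectiveʳ = combine-injectiveʳ

  block-at : ∀ β i → block (at β i) ≡ β
  block-at β i = cong proj₁ (remQuot-combine β i)

  ≡-fromBlockPosition : ∀ {u v} → block u ≡ block v → position u ≡ position v → u ≡ v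
  ≡-fromBlockPosition {u} {v} eb ep =
    trans (sym (combine-remQuot {suc (suc T)} (suc (suc s)) u))
          (trans (cong₂ combine eb ep) (combine-remQuot {suc (suc T)} (suc (suc s)) v))

  blockColour : Vertex → Vertex → ℕ
  blockColour u v = if does (block u ≟ block v) then suc (toℕ u ⊔ toℕ v) else 0

  blockColour-sym : ∀ u v → blockColour u v ≡ blockColour v u
  blockColour-sym u v with block u ≟ block v | block v ≟ block u
  ... | yes _    | yes _    = cong suc (ℕ.⊔-comm (toℕ u) (toℕ v))
  ... | no _     | no _     = refl
  ... | yes u≡v  | no v≢u   = contradiction (sym u≡v) v≢u
  ... | no u≢v   | yes v≡u  = contradiction (sym v≡u) u≢v

  colouring : Coloring (suc (suc T) * suc (suc s))
  colouring = record { col = blockColour ; col-sym = blockColour-sym }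

  sameBlock-colour : ∀ u v → block u ≡ block v → blockColour u v ≡ suc (toℕ u ⊔ toℕ v)
  sameBlock-colour u v e rewrite dec-true (block u ≟ block v) e = refl

  otherBlock-colour : ∀ u v → block u ≢ block v → blockColour u v ≡ 0
  otherBlock-colour u v ne rewrite dec-false (block u ≟ block v) ne = refl

  -- Spokes from x into its own block are told apart by the position of the leaf, which is never
  -- position x; all other spokes have colour 0 and are sent to position x.
  spokeClass : Vertex → Vertex → Fin (suc (suc s))
  spokeClass x y = if does (block x ≟ block y) then position y else position x

  sameClass⇒sameColour : ∀ {x y y'} → y ≢ x → y' ≢ x → spokeClass x y ≡ spokeClass x y' →
    blockColour x y ≡ blockColour x y'
  sameClass⇒sameColour {x} {y} {y'} y≢x y'≢x same with block x ≟ block y | block x ≟ block y'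
  ... | yes e | yes e' = cong (λ v → suc (toℕ x ⊔ toℕ v)) (≡-fromBlockPosition (trans (sym e) e') same)
  ... | yes e | no _   = contradiction (≡-fromBlockPosition (sym e) same) y≢x
  ... | no _  | yes e' = contradiction (≡-fromBlockPosition (sym e') (sym same)) y'≢x
  ... | no _  | no _   = refl

  noRainbowStar : ¬ RainbowStar colouring (suc (suc (suc s)))
  noRainbowStar st with pigeonhole (ℕ.n<1+n _) (λ i → spokeClass (centre st) (leaf st i))
  ... | i , j , i<j , same = ℕ.<-irrefl (cong toℕ (spoke-injective st
          (sameClass⇒sameColour {centre st} (leaf≢centre st i) (leaf≢centre st j) same))) i<j

  rainbowStar : RainbowStar colouring (suc (suc s))
  rainbowStar = record
    { centre          = at zero zero
    ; leaf            = leaf′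
    ; leaf≢centre     = λ { zero eq → contradiction (at-injectiveˡ (suc zero) zero zero zero eq) λ ()
                          ; (suc j) eq → contradiction (at-injectiveʳ zero (suc j) zero zero eq) λ () }
    ; spoke-injective = spokes-injective
    }
    where
    leaf′ : Fin (suc (suc s)) → Vertex
    leaf′ zero    = at (suc zero) zero
    leaf′ (suc j) = at zero (suc j)
    spoke′ : Fin (suc (suc s)) → ℕ
    spoke′ i = blockColour (at zero zero) (leaf′ i)
    spoke-zero : spoke′ zero ≡ 0
    spoke-zero = otherBlock-colour (at zero zero) (at (suc zero) zero)
      (subst₂ _≢_ (sym (block-at zero zero)) (sym (block-at (suc zero) zero)) λ ())
    spoke-suc : ∀ j → spoke′ (suc j) ≡ suc (toℕ (at zero (suc j)))
    spoke-suc j = sameBlock-colour (at zero zero) (at zero (suc j))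
      (trans (block-at zero zero) (sym (block-at zero (suc j))))
    spokes-injective : Injective _≡_ _≡_ spoke′
    spokes-injective {zero}  {zero}  _  = refl
    spokes-injective {zero}  {suc j} eq = contradiction (trans (sym spoke-zero) (trans eq (spoke-suc j))) λ ()
    spokes-injective {suc i} {zero}  eq = contradiction (trans (sym spoke-zero) (trans (sym eq) (spoke-suc i))) λ ()
    spokes-injective {suc i} {suc j} eq = at-injectiveʳ zero (suc i) zero (suc j)
      (toℕ-injective (ℕ.suc-injective (trans (sym (spoke-suc i)) (trans eq (spoke-suc j)))))

  numColors-≥T : T ≤ numColors colouring
  numColors-≥T = numColors-≥ colouring g g-injective λ b →
    col∈colours colouring {at (β b) zero} {at (β b) (suc zero)}
      (λ eq → contradiction (at-injectiveʳ (β b) zero (β b) (suc zero) eq) λ ())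
    where
    β : Fin T → Fin (suc (suc T))
    β b = inject≤ b (ℕ.m≤n+m T 2)
    g : Fin T → ℕ
    g b = blockColour (at (β b) zero) (at (β b) (suc zero))
    g≡ : ∀ b → g b ≡ suc (toℕ (at (β b) (suc zero)))
    g≡ b = trans (sameBlock-colour (at (β b) zero) (at (β b) (suc zero))
                   (trans (block-at (β b) zero) (sym (block-at (β b) (suc zero)))))
                 (cong suc (ℕ.m≤n⇒m⊔n≡n first≤second))
      where
      first≤second : toℕ (at (β b) zero) ≤ toℕ (at (β b) (suc zero))
      first≤second = subst₂ _≤_ (sym (toℕ-combine (β b) zero)) (sym (toℕ-combine (β b) (suc zero)))
        (ℕ.+-monoʳ-≤ (suc (suc s) * toℕ (β b)) z≤n)
    g-injective : Injective _≡_ _≡_ g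
    g-injective {a} {b} eq = inject≤-injective _ _ a b (at-injectiveˡ (β a) (suc zero) (β b) (suc zero)
      (toℕ-injective (ℕ.suc-injective (trans (sym (g≡ a)) (trans eq (g≡ b))))))

K1≼K1⇒≤ : ∀ {a b} → 3 ≤ a → K1 a ≼ K1 b → a ≤ b
K1≼K1⇒≤ {suc (suc zero)} (s≤s (s≤s ()))
K1≼K1⇒≤ {suc (suc (suc s))} {b} _ (t , _ , h) with b ℕ.≤? suc (suc s)
... | no b≰ = ℕ.≰⇒> b≰
... | yes b≤ = ⊥-elim (h _ colouring numColors-≥T (noRainbowStar ∘ RainbowCopy⇒RainbowStar)
  (RainbowStar⇒RainbowCopy (restrict rainbowStar (λ i → inject≤ i b≤) (inject≤-injective _ _ _ _))))
  where open Blocks t s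

-- A subdivided star lies below the star

avoidingIndices : ∀ {n r k'} {c : Coloring n} (st : RainbowStar c r) → suc k' ≤ r → (κ : ℕ) →
  Σ (Fin k' → Fin r) λ ι → Injective _≡_ _≡_ ι × ∀ i → spoke st (ι i) ≢ κ
avoidingIndices st (s≤s k'≤r) κ with any? (λ m → spoke st m ℕ.≟ κ)
... | yes (m , spoke≡κ) =
  (λ i → punchIn m (inject≤ i k'≤r)) ,
  (λ eq → inject≤-injective _ _ _ _ (punchIn-injective m _ _ eq)) ,
  λ i eq → punchInᵢ≢i m (inject≤ i k'≤r) (spoke-injective st (trans eq (sym spoke≡κ)))
... | no none =
  (λ i → inject≤ i (ℕ.m≤n⇒m≤1+n k'≤r)) , (λ eq → inject≤-injective _ _ _ _ eq) , λ i eq → none (_ , eq)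

-- The copy has centre st, subdivided leaf l with pendant p, and the leaves of st as its other leaves.
K1plusFromLeafAndPendant : ∀ {n k'} {c : Coloring n} (st : RainbowStar c k') (l p : Fin n) →
  l ≢ centre st → p ≢ centre st → l ≢ p → (∀ i → leaf st i ≢ p) →
  (∀ i → col c (centre st) l ≢ spoke st i) → (∀ i → col c l p ≢ spoke st i) →
  col c (centre st) l ≢ col c l p → RainbowCopy (K1plus (suc k')) c
K1plusFromLeafAndPendant {c = c} st l p l≢v p≢v l≢p leaf≢p l-fresh lp-fresh vl≢lp =
  RainbowStar⇒K1plusCopy (addLeaf st l l≢v l-fresh) p p-fresh colour-fresh
  where
  p-fresh : ∀ x → vertex (addLeaf st l l≢v l-fresh) x ≢ p
  p-fresh zero          = p≢v ∘ sym
  p-fresh (suc zero)    = l≢p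
  p-fresh (suc (suc i)) = leaf≢p i
  colour-fresh : ∀ i → col c l p ≢ spoke (addLeaf st l l≢v l-fresh) i
  colour-fresh zero    = vl≢lp ∘ sym
  colour-fresh (suc i) = lp-fresh i

module _ {n} {c : Coloring n} where

  innerColour : ∀ {r} → RainbowStar c r → Fin (suc r * suc r) → ℕ
  innerColour {r} st e = col c (vertex st (quotient (suc r) e)) (vertex st (remainder {suc r} (suc r) e))

  innerColours : ∀ {r} → RainbowStar c r → List ℕ
  innerColours st = tabulate (innerColour st)

  length-innerColours : ∀ {r} (st : RainbowStar c r) → length (innerColours st) ≡ suc r * suc r
  length-innerColours st = length-tabulate (innerColour st)

  inner∈innerColours : ∀ {r} (st : RainbowStar c r) x y → col c (vertex st x) (vertex st y) ∈ innerColours st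
  inner∈innerColours st x y = subst (_∈ innerColours st)
    (cong (λ e → col c (vertex st (proj₁ e)) (vertex st (proj₂ e))) (remQuot-combine x y))
    (∈-tabulate⁺ {f = innerColour st} (combine x y))

  spoke∈innerColours : ∀ {r} (st : RainbowStar c r) i → spoke st i ∈ innerColours st
  spoke∈innerColours st i = inner∈innerColours st zero (suc i)

  ∉innerColours⇒≢spoke : ∀ {r} (st : RainbowStar c r) {κ} → κ ∉ innerColours st → ∀ i → κ ≢ spoke st i
  ∉innerColours⇒≢spoke st κ∉ i κ≡ = κ∉ (subst (_∈ innerColours st) (sym κ≡) (spoke∈innerColours st i))

K1plusFromFirstTwoLeaves : ∀ {n k'} {c : Coloring n} (st : RainbowStar c (suc (suc (suc k')))) →
  spoke st zero ≢ col c (leaf st zero) (leaf st (suc zero)) → RainbowCopy (K1plus (suc k')) c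
K1plusFromFirstTwoLeaves {k' = k'} {c} st differ =
  K1plusFromLeafAndPendant (restrict others ι ι-injective) (leaf st zero) (leaf st (suc zero))
    (leaf≢centre st zero) (leaf≢centre st (suc zero)) (λ eq → case leaf-injective st eq of λ ())
    (λ i eq → case leaf-injective st eq of λ ()) (λ i eq → case spoke-injective st eq of λ ())
    (λ i → avoid i ∘ sym) differ
  where
  others : RainbowStar c (suc k')
  others = restrict st (λ i → suc (suc i)) (suc-injective ∘ suc-injective)
  open Σ (avoidingIndices others ℕ.≤-refl (col c (leaf st zero) (leaf st (suc zero))))
    renaming (proj₁ to ι; proj₂ to ι-properties)
  ι-injective = proj₁ ι-properties
  avoid = proj₂ ι-properties

module Growth {n k'} (c : Coloring n) (noPlus : ¬ RainbowCopy (K1plus (suc k')) c) where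

  extendAt : ∀ {r} (st : RainbowStar c r) → suc k' ≤ r → ∀ a b → a ≢ b → (∀ x → vertex st x ≢ b) →
    col c a b ∉ innerColours st → RainbowStar c (suc r)
  extendAt st k<r a b a≢b b-fresh ab∉ with a ≟ centre st
  ... | yes refl = addLeaf st b (b-fresh zero ∘ sym) (∉innerColours⇒≢spoke st ab∉)
  ... | no a≢v with col c (centre st) a ℕ.≟ col c a b
  ...   | yes same = addLeaf st a a≢v (subst (λ κ → ∀ i → κ ≢ spoke st i) (sym same) (∉innerColours⇒≢spoke st ab∉))
  ...   | no differ =
    let (ι , ι-injective , avoid) = avoidingIndices st k<r (col c (centre st) a)
    in ⊥-elim (noPlus (K1plusFromLeafAndPendant (restrict st ι ι-injective) a b a≢v (b-fresh zero ∘ sym) a≢b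
         (b-fresh ∘ suc ∘ ι) (λ i → avoid i ∘ sym) (∉innerColours⇒≢spoke st ab∉ ∘ ι) differ))

  grow : ∀ {r} (st : RainbowStar c r) → suc k' ≤ r → length (innerColours st) < numColors c → RainbowStar c (suc r)
  grow st k<r short with colour-outside c (innerColours st) short
  ... | a , b , a≢b , ab∉ with any? (λ x → vertex st x ≟ a) | any? (λ y → vertex st y ≟ b)
  ...   | yes (x , refl) | yes (y , refl) = contradiction (inner∈innerColours st x y) ab∉
  ...   | _              | no b∉          = extendAt st k<r a b a≢b (λ y eq → b∉ (y , eq)) ab∉
  ...   | no a∉          | yes _          =
    extendAt st k<r b a (a≢b ∘ sym) (λ x eq → a∉ (x , eq)) (ab∉ ∘ subst (_∈ innerColours st) (col-sym c b a))

  noLargeStar : ¬ RainbowStar c (suc (suc (suc k')))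
  noLargeStar st with spoke st zero ℕ.≟ col c (leaf st zero) (leaf st (suc zero))
  ... | no differ = noPlus (K1plusFromFirstTwoLeaves st differ)
  ... | yes same  = noPlus (K1plusFromFirstTwoLeaves (restrict st (swap ⟨$⟩ʳ_) (↔-injective swap))
                      λ eq → case spoke-injective st (trans eq (trans (col-sym c _ _) (sym same))) of λ ())
    where swap = transpose zero (suc zero)

K1plus≼K1 : ∀ k' → K1plus (suc k') ≼ K1 (suc k')
K1plus≼K1 k' = suc (R * R) , s≤s z≤n , λ n c many noPlus copy →
  let open Growth c noPlus
      st₀ = RainbowCopy⇒RainbowStar copy
      st₁ = grow st₀ ℕ.≤-refl (ℕ.≤-trans (bound st₀ (ℕ.n≤1+n _)) many)
      st₂ = grow st₁ (ℕ.n≤1+n _) (ℕ.≤-trans (bound st₁ ℕ.≤-refl) many)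
  in noLargeStar st₂
  where
  R = suc (suc (suc k'))
  bound : ∀ {n r} {c : Coloring n} (st : RainbowStar c r) → suc r ≤ R → length (innerColours st) < suc (R * R)
  bound st r<R rewrite length-innerColours st = s≤s (ℕ.*-mono-≤ r<R r<R)

-- The equivalence class of a star

squeezed : ∀ {k m} → k ≤ m → m ≤ suc k → m ≡ k ⊎ m ≡ suc k
squeezed k≤m m≤k+1 with ℕ.m≤n⇒m<n∨m≡n m≤k+1
... | inj₁ (s≤s m≤k) = inj₁ (ℕ.≤-antisym m≤k k≤m)
... | inj₂ m≡k+1     = inj₂ m≡k+1

StarOrPlus : Graph → ℕ → Set
StarOrPlus H m = (H ≅ K1 m) ⊎ (H ≅ K1plus m)

StarOrPlus⇒≈ᵍK1 : ∀ {H m} → 1 ≤ m → StarOrPlus H m → H ≈ᵍ K1 m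
StarOrPlus⇒≈ᵍK1 {H} {m} _ (inj₁ iso) = ≅⇒≈ᵍ {H} {K1 m} iso
StarOrPlus⇒≈ᵍK1 {H} {suc m} _ (inj₂ iso) =
  (begin H ≲⟨ H≼K1plus ⟩ K1plus (suc m) ≲⟨ K1plus≼K1 m ⟩ K1 (suc m) ∎) ,
  (begin K1 (suc m) ≲⟨ Embedding⇒≼ (K1↪K1plus m) ⟩ K1plus (suc m) ≲⟨ K1plus≼H ⟩ H ∎)
  where
  open ≼-Reasoning
  open Σ (≅⇒≈ᵍ {H} {K1plus (suc m)} iso) renaming (proj₁ to H≼K1plus; proj₂ to K1plus≼H)

≼K1⇒StarOrPlus : ∀ {H k} → Connected H → H ≼ K1 k → Σ ℕ λ m → StarOrPlus H m × H ≈ᵍ K1 m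
≼K1⇒StarOrPlus {H} connected H≼K1 with ≼K1⇒shape connected H≼K1
... | inj₁ (m , iso) = m , inj₁ iso , ≅⇒≈ᵍ {H} {K1 m} iso
... | inj₂ (m , iso) = suc m , inj₂ iso , StarOrPlus⇒≈ᵍK1 {H} (s≤s z≤n) (inj₂ iso)

sandwiched⇒StarOrPlus : ∀ {H a b} → 3 ≤ a → Connected H → K1 a ≼ H → H ≼ K1 b →
  Σ ℕ λ m → a ≤ m × m ≤ b × StarOrPlus H m
sandwiched⇒StarOrPlus {H} {a} {b} 3≤a connected K1a≼H H≼K1b
  with m , shape , H≼K1m , K1m≼H ← ≼K1⇒StarOrPlus connected H≼K1b =
  let a≤m = K1≼K1⇒≤ 3≤a (begin K1 a ≲⟨ K1a≼H ⟩ H ≲⟨ H≼K1m ⟩ K1 m ∎)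
  in m , a≤m , K1≼K1⇒≤ (ℕ.≤-trans 3≤a a≤m) (begin K1 m ≲⟨ K1m≼H ⟩ H ≲⟨ H≼K1b ⟩ K1 b ∎) , shape
  where open ≼-Reasoning

corollary21 : (k : ℕ) → 3 ≤ k →
    ((H : Graph) → InH H → (H ≈ᵍ K1 k → (H ≅ K1 k) ⊎ (H ≅ K1plus k))
                         × ((H ≅ K1 k) ⊎ (H ≅ K1plus k) → H ≈ᵍ K1 k))
    × (K1 k ≼ K1 (suc k))
    × ¬ (K1 (suc k) ≼ K1 k)
    × ((H : Graph) → InH H → K1 k ≼ H → H ≼ K1 (suc k) →
         (H ≈ᵍ K1 k) ⊎ (H ≈ᵍ K1 (suc k)))
corollary21 k 3≤k = equivalenceClass , Embedding⇒≼ (K1↪K1suc k) , K1k+1⋠K1k , nothingBetween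
  where
  1≤k : 1 ≤ k
  1≤k = ℕ.≤-trans (s≤s z≤n) 3≤k
  K1k+1⋠K1k : ¬ (K1 (suc k) ≼ K1 k)
  K1k+1⋠K1k h = ℕ.<-irrefl refl (K1≼K1⇒≤ (ℕ.m≤n⇒m≤1+n 3≤k) h)
  equivalenceClass : (H : Graph) → InH H → (H ≈ᵍ K1 k → StarOrPlus H k) × (StarOrPlus H k → H ≈ᵍ K1 k)
  equivalenceClass H (connected , _) = classOf , StarOrPlus⇒≈ᵍK1 {H} 1≤k
    where
    classOf : H ≈ᵍ K1 k → StarOrPlus H k
    classOf (H≼K1k , K1k≼H) =
      let (m , k≤m , m≤k , shape) = sandwiched⇒StarOrPlus {H} {k} {k} 3≤k connected K1k≼H H≼K1k
      in subst (StarOrPlus H) (ℕ.≤-antisym m≤k k≤m) shape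
  nothingBetween : (H : Graph) → InH H → K1 k ≼ H → H ≼ K1 (suc k) → (H ≈ᵍ K1 k) ⊎ (H ≈ᵍ K1 (suc k))
  nothingBetween H (connected , _) K1k≼H H≼K1k+1 =
    let (m , k≤m , m≤k+1 , shape) = sandwiched⇒StarOrPlus {H} {k} {suc k} 3≤k connected K1k≼H H≼K1k+1
        H≈K1m = StarOrPlus⇒≈ᵍK1 {H} (ℕ.≤-trans 1≤k k≤m) shape
        transport = λ {x} m≡x → subst (λ y → H ≈ᵍ K1 y) {y = x} m≡x H≈K1m
    in Sum.map transport transport (squeezed k≤m m≤k+1)
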